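{- Let $(j_n)_{n\ge 0}$ be defined by $j_0=0$, $j_{2k}=j_k$ and $j_{2k+1}=(-1)^k$ for all $k\ge 0$, and let $s_n=1+\sum_{0\le k\le n} j_k$. Let $(b_n)_{n\ge 0}$ be the increasing sequence of positive integers whose odd part is of the form $4k+3$. Then $b_n-s_{b_n}=2n+1$ for all $n\ge 0$.
   Context: The odd part of a positive integer $m$ is the odd integer $m/2^{v}$ where $2^v$ is the largest power of $2$ dividing $m$. -}

module Defs where

open import Data.Nat using (ℕ; zero; suc; _+_; _*_; _%_; _/_; _≡ᵇ_)
open import Data.Bool using (Bool; true; false; if_then_else_)
open import Data.Integer using (ℤ; +_; -_; 0ℤ; 1ℤ) renaming (_+_ to _+ℤ_)

neg1^ : ℕ → ℤ
neg1^ zero = 1ℤ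
neg1^ (suc k) = - neg1^ k

-- j, defined by j_0 = 0, j_{2k} = j_k, j_{2k+1} = (-1)^k.
-- Implemented with fuel (fuel ≥ n suffices, since halving strictly decreases a positive n).
jAux : ℕ → ℕ → ℤ
jAux zero n = 0ℤ
jAux (suc f) n with n % 2
... | zero = if n ≡ᵇ 0 then 0ℤ else jAux f (n / 2)
... | suc _ = neg1^ (n / 2)

j : ℕ → ℤ
j n = jAux n n

sumJ : ℕ → ℤ
sumJ zero = j zero
sumJ (suc n) = sumJ n +ℤ j (suc n)

s : ℕ → ℤ
s n = 1ℤ +ℤ sumJ n

-- odd part of a positive integer m (oddPart 0 = 0 by convention, never used)
oddPartAux : ℕ → ℕ → ℕ
oddPartAux zero m = m
oddPartAux (suc f) m with m % 2
... | zero = if m ≡ᵇ 0 then 0 else oddPartAux f (m / 2)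
... | suc _ = m

oddPart : ℕ → ℕ
oddPart m = oddPartAux m m

inB : ℕ → Bool
inB zero = false
inB m@(suc _) = oddPart m % 4 ≡ᵇ 3

-- least y > x with inB y, searching x+1, ..., x+4 (one of which is ≡ 3 mod 4,
-- hence its own odd part and in the set, so the search always succeeds)
nextB : ℕ → ℕ
nextB x = if inB (x + 1) then x + 1
          else if inB (x + 2) then x + 2
          else if inB (x + 3) then x + 3
          else x + 4

b : ℕ → ℕ
b zero = nextB 0
b (suc n) = nextB (b n)

{-# OPTIONS --safe #-}
module Submission where

-- For m ≥ 1, unfolding j_{2k} = j_k down to the odd part o of m gives j_m = (-1)^((o-1)/2),
-- so j_m = -1 exactly when m belongs to B = {m ≥ 1 : o ≡ 3 mod 4} and j_m = 1 otherwise.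
-- Hence s_m = 1 + m - 2 |B ∩ [1, m]|, and since b_n is the (n+1)-st element of B,
-- b_n - s_{b_n} = 2(n + 1) - 1.

open import Defs
open import Data.Nat using (ℕ; zero; suc; _%_; _/_; _≡ᵇ_; _≤_; _<_; s≤s; z≤n)
  renaming (_+_ to _+ₙ_; _*_ to _*ₙ_)
open import Data.Nat.Properties using (+-comm; *-comm; ≤-refl; ≤-pred; <-≤-trans)
open import Data.Nat.DivMod
  using (m≡m%n+[m/n]*n; [m+n]%n≡m%n; m∣n⇒o%n%m≡o%m; m%n<n; m/n<m; m≥n⇒m/n>0)
open import Data.Nat.Divisibility using (divides)
open import Data.Nat.Tactic.RingSolver using () renaming (solve-∀ to solve-ℕ)
open import Data.Bool using (true; false; if_then_else_)
open import Data.Bool.Properties using (not-¬)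
open import Data.Integer using (ℤ; +_; _-_; _+_; _*_; -_; -1ℤ; 1ℤ)
open import Data.Integer.Properties using (neg-involutive)
open import Data.Integer.Tactic.RingSolver using (solve-∀)
open import Data.Sum using (_⊎_; inj₁; inj₂)
import Data.Sum as Sum
open import Relation.Nullary using (contradiction)
open import Relation.Binary.PropositionalEquality
open ≡-Reasoning

signMod4 : ℕ → ℤ
signMod4 m = if m % 4 ≡ᵇ 3 then -1ℤ else 1ℤ

%4-periodic : ∀ m → (4 +ₙ m) % 4 ≡ m % 4
%4-periodic m = trans (cong (_% 4) (+-comm 4 m)) ([m+n]%n≡m%n m 4)

neg1^≡signMod4[1+2k] : ∀ k → neg1^ k ≡ signMod4 (1 +ₙ 2 *ₙ k)
neg1^≡signMod4[1+2k] zero = refl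
neg1^≡signMod4[1+2k] (suc zero) = refl
neg1^≡signMod4[1+2k] (suc (suc k)) = begin
  - - neg1^ k                          ≡⟨ neg-involutive (neg1^ k) ⟩
  neg1^ k                              ≡⟨ neg1^≡signMod4[1+2k] k ⟩
  signMod4 (1 +ₙ 2 *ₙ k)               ≡⟨ cong (λ r → if r ≡ᵇ 3 then -1ℤ else 1ℤ)
                                             (%4-periodic (1 +ₙ 2 *ₙ k)) ⟨
  signMod4 (4 +ₙ (1 +ₙ 2 *ₙ k))        ≡⟨ cong signMod4 (rearrange k) ⟩
  signMod4 (1 +ₙ 2 *ₙ (2 +ₙ k))        ∎
  where
  rearrange : ∀ k → 4 +ₙ (1 +ₙ 2 *ₙ k) ≡ 1 +ₙ 2 *ₙ (2 +ₙ k)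
  rearrange = solve-ℕ

odd⇒≡1+2*[n/2] : ∀ n {r} → n % 2 ≡ suc r → n ≡ 1 +ₙ 2 *ₙ (n / 2)
odd⇒≡1+2*[n/2] n n%2≡1+r = begin
  n                        ≡⟨ m≡m%n+[m/n]*n n 2 ⟩
  n % 2 +ₙ n / 2 *ₙ 2      ≡⟨ cong₂ _+ₙ_ (remainder-one n%2≡1+r (m%n<n n 2)) (*-comm (n / 2) 2) ⟩
  1 +ₙ 2 *ₙ (n / 2)        ∎
  where
  remainder-one : ∀ {t r} → t ≡ suc r → t < 2 → t ≡ 1
  remainder-one {r = zero} refl _ = refl
  remainder-one {r = suc r} refl (s≤s (s≤s ()))

even⇒n/2>0 : ∀ n → n % 2 ≡ 0 → 1 ≤ n → 1 ≤ n / 2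
even⇒n/2>0 (suc (suc n)) _ _ = m≥n⇒m/n>0 {2 +ₙ n} (s≤s (s≤s z≤n))
even⇒n/2>0 (suc zero) () _

jAux≡signMod4∘oddPartAux : ∀ f n → 1 ≤ n → n ≤ f → jAux f n ≡ signMod4 (oddPartAux f n)
jAux≡signMod4∘oddPartAux (suc f) (suc n) 1≤n n≤f with suc n % 2 in n%2
... | zero = jAux≡signMod4∘oddPartAux f (suc n / 2) (even⇒n/2>0 (suc n) n%2 1≤n)
               (≤-pred (<-≤-trans (m/n<m (suc n) 2 (s≤s (s≤s z≤n))) n≤f))
... | suc _ = trans (neg1^≡signMod4[1+2k] (suc n / 2))
                    (cong signMod4 (sym (odd⇒≡1+2*[n/2] (suc n) n%2)))

j-suc : ∀ m → j (suc m) ≡ (if inB (suc m) then -1ℤ else 1ℤ)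
-- The right-hand side is signMod4 (oddPart (suc m)) unfolded.
j-suc m = jAux≡signMod4∘oddPartAux (suc m) (suc m) (s≤s z≤n) ≤-refl

countB : ℕ → ℕ
countB zero = 0
countB (suc m) = (if inB (suc m) then 1 else 0) +ₙ countB m

countB-hit : ∀ m → inB (suc m) ≡ true → countB (suc m) ≡ suc (countB m)
countB-hit _ e rewrite e = refl

countB-skip : ∀ m → inB (suc m) ≡ false → countB (suc m) ≡ countB m
countB-skip _ e rewrite e = refl

sumJ≡m-2*countB : ∀ m → sumJ m ≡ + m - + 2 * + countB m
sumJ≡m-2*countB zero = refl
sumJ≡m-2*countB (suc m) rewrite j-suc m | sumJ≡m-2*countB m with inB (suc m)
... | true = identity (+ m) (+ countB m)
  where
  identity : ∀ a c → a - + 2 * c + -1ℤ ≡ + 1 + a - + 2 * (+ 1 + c)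
  identity = solve-∀
... | false = identity (+ m) (+ countB m)
  where
  identity : ∀ a c → a - + 2 * c + 1ℤ ≡ + 1 + a - + 2 * c
  identity = solve-∀

inB-of-3mod4 : ∀ m → m % 4 ≡ 3 → inB m ≡ true
inB-of-3mod4 zero ()
inB-of-3mod4 m@(suc _) m%4≡3
  rewrite trans (sym (m∣n⇒o%n%m≡o%m 2 4 m (divides 2 refl))) (cong (_% 2) m%4≡3)
  = cong (_≡ᵇ 3) m%4≡3

3mod4-among-next-four : ∀ x →
  (1 +ₙ x) % 4 ≡ 3 ⊎ (2 +ₙ x) % 4 ≡ 3 ⊎ (3 +ₙ x) % 4 ≡ 3 ⊎ (4 +ₙ x) % 4 ≡ 3
3mod4-among-next-four 0 = inj₂ (inj₂ (inj₁ refl))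
3mod4-among-next-four 1 = inj₂ (inj₁ refl)
3mod4-among-next-four 2 = inj₁ refl
3mod4-among-next-four 3 = inj₂ (inj₂ (inj₂ refl))
3mod4-among-next-four (suc (suc (suc (suc x)))) =
  Sum.map (shift (1 +ₙ x)) (Sum.map (shift (2 +ₙ x)) (Sum.map (shift (3 +ₙ x)) (shift (4 +ₙ x))))
    (3mod4-among-next-four x)
  where
  shift : ∀ m → m % 4 ≡ 3 → (4 +ₙ m) % 4 ≡ 3
  shift m = trans (%4-periodic m)

inB-within-four : ∀ x → inB (1 +ₙ x) ≡ false → inB (2 +ₙ x) ≡ false → inB (3 +ₙ x) ≡ false →
                  inB (4 +ₙ x) ≡ true
inB-within-four x e₁ e₂ e₃ with 3mod4-among-next-four x
... | inj₁ r = contradiction (inB-of-3mod4 (1 +ₙ x) r) (not-¬ e₁)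
... | inj₂ (inj₁ r) = contradiction (inB-of-3mod4 (2 +ₙ x) r) (not-¬ e₂)
... | inj₂ (inj₂ (inj₁ r)) = contradiction (inB-of-3mod4 (3 +ₙ x) r) (not-¬ e₃)
... | inj₂ (inj₂ (inj₂ r)) = inB-of-3mod4 (4 +ₙ x) r

countB-nextB : ∀ x → countB (nextB x) ≡ suc (countB x)
-- nextB is phrased with x + k, which does not compute; commute to k + x first.
countB-nextB x rewrite +-comm x 1 | +-comm x 2 | +-comm x 3 | +-comm x 4
  with inB (1 +ₙ x) in e₁
... | true = countB-hit x e₁
... | false with inB (2 +ₙ x) in e₂
...   | true = trans (countB-hit (1 +ₙ x) e₂) (cong suc (countB-skip x e₁))
...   | false with inB (3 +ₙ x) in e₃
...     | true = trans (countB-hit (2 +ₙ x) e₃) (cong suc skip₂)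
  where
  skip₂ : countB (2 +ₙ x) ≡ countB x
  skip₂ = trans (countB-skip (1 +ₙ x) e₂) (countB-skip x e₁)
...     | false = trans (countB-hit (3 +ₙ x) (inB-within-four x e₁ e₂ e₃)) (cong suc skip₃)
  where
  skip₃ : countB (3 +ₙ x) ≡ countB x
  skip₃ = trans (countB-skip (2 +ₙ x) e₃) (trans (countB-skip (1 +ₙ x) e₂) (countB-skip x e₁))

countB-b : ∀ n → countB (b n) ≡ suc n
countB-b zero = countB-nextB 0
countB-b (suc n) = trans (countB-nextB (b n)) (cong suc (countB-b n))

theorem7 : (n : ℕ) → (+ b n) - s (b n) ≡ (+ 2) * (+ n) + (+ 1)
theorem7 n rewrite sumJ≡m-2*countB (b n) | countB-b n = identity (+ b n) (+ n)
  where
  identity : ∀ a c → a - (+ 1 + (a - + 2 * (+ 1 + c))) ≡ + 2 * c + + 1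
  identity = solve-∀
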